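{- For every integer $n \geq 3$ and every prime power $q$, there exists a code $\mathbb{C} \subseteq \mathcal{G}_q\big(\binom{n}{2}, n-1\big)$ with $|\mathbb{C}| = \frac{q^n-1}{q-1}$ such that $\dim(X \cap Y) = 1$ for every two distinct $X, Y \in \mathbb{C}$ (i.e. $\mathbb{C}$ is a $1$-intersecting equidistant code).
   Context: $\mathbb{F}_q$ is the finite field with $q$ elements. $\mathcal{G}_q(N,k)$ denotes the set of all $k$-dimensional subspaces of $\mathbb{F}_q^N$. A code $\mathbb{C}\subseteq \mathcal{G}_q(N,k)$ is called $t$-intersecting if any two distinct codewords intersect in a subspace of dimension exactly $t$; such a code is equidistant with respect to the subspace distance $d_S(X,Y)=\dim X+\dim Y-2\dim(X\cap Y)$. Note $\frac{q^n-1}{q-1}$ is the number of $1$-dimensional subspaces of $\mathbb{F}_q^n$. -}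

module Defs where

open import Level using (Level; _⊔_)
open import Data.Nat using (ℕ; zero; suc; _^_; _≤_)
open import Data.Nat.Primality using (Prime)
open import Data.Fin using (Fin)
open import Data.Product using (Σ; ∃; _×_; _,_)
open import Relation.Nullary using (¬_)
open import Relation.Binary.PropositionalEquality using (_≡_)
open import Algebra.Bundles using (CommutativeRing)

IsPrimePower : ℕ → Set
IsPrimePower q = Σ ℕ λ p → Σ ℕ λ k → Prime p × (1 ≤ k) × (q ≡ p ^ k)

record IsField {c ℓ : Level} (R : CommutativeRing c ℓ) : Set (c ⊔ ℓ) where
  open CommutativeRing R
  field
    0≉1     : ¬ (0# ≈ 1#)
    inverse : ∀ x → ¬ (x ≈ 0#) → ∃ λ y → (x * y) ≈ 1#

record FiniteField (c ℓ : Level) (q : ℕ) : Set (Level.suc (c ⊔ ℓ)) where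
  field
    cring   : CommutativeRing c ℓ
    isField : IsField cring
  open CommutativeRing cring public
  field
    enum      : Fin q → Carrier
    enum-inj  : ∀ i j → enum i ≈ enum j → i ≡ j
    enum-surj : ∀ x → ∃ λ i → enum i ≈ x

module LinAlg {c ℓ : Level} {q : ℕ} (F : FiniteField c ℓ q) where
  open FiniteField F

  Vector : ℕ → Set c
  Vector N = Fin N → Carrier

  Σᶠ : (k : ℕ) → (Fin k → Carrier) → Carrier
  Σᶠ zero    f = 0#
  Σᶠ (suc k) f = f Fin.zero + Σᶠ k (λ j → f (Fin.suc j))

  IsZero : ∀ {N} → Vector N → Set ℓ
  IsZero v = ∀ i → v i ≈ 0#

  lincomb : ∀ {N k} → (Fin k → Carrier) → (Fin k → Vector N) → Vector N
  lincomb {k = k} coef b i = Σᶠ k (λ j → coef j * b j i)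

  LinIndep : ∀ {N k} → (Fin k → Vector N) → Set (c ⊔ ℓ)
  LinIndep {k = k} b = ∀ (coef : Fin k → Carrier) → IsZero (lincomb coef b) → ∀ j → coef j ≈ 0#

  InSpan : ∀ {N k} → Vector N → (Fin k → Vector N) → Set (c ⊔ ℓ)
  InSpan {k = k} v b = ∃ λ (coef : Fin k → Carrier) → ∀ i → v i ≈ lincomb coef b i

  record Subspace (N k : ℕ) : Set (c ⊔ ℓ) where
    field
      basis  : Fin k → Vector N
      indep  : LinIndep basis
  open Subspace public

  _∈ₛ_ : ∀ {N k} → Vector N → Subspace N k → Set (c ⊔ ℓ)
  v ∈ₛ X = InSpan v (basis X)

  SameSubspace : ∀ {N k} → Subspace N k → Subspace N k → Set (c ⊔ ℓ)
  SameSubspace X Y = (∀ v → v ∈ₛ X → v ∈ₛ Y) × (∀ v → v ∈ₛ Y → v ∈ₛ X)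

  IntersectionDim1 : ∀ {N k} → Subspace N k → Subspace N k → Set (c ⊔ ℓ)
  IntersectionDim1 {N} X Y =
    ∃ λ (v : Vector N) → ¬ IsZero v × v ∈ₛ X × v ∈ₛ Y ×
      (∀ w → w ∈ₛ X → w ∈ₛ Y → ∃ λ a → ∀ i → w i ≈ a * v i)

module Submission where

-- For a point ⟨u⟩ of PG(n-1, q) let X_u = { u ∧ x : x ∈ F_q^n } ⊆ Λ²F_q^n ≅ F_q^(n C 2). Normalising u to
-- have a coordinate p with u_p = 1, the vectors u ∧ e_t (t ≠ p) form a basis of X_u, so dim X_u = n - 1.
-- For distinct points u ∧ v ≠ 0 lies in X_u ∩ X_v, and if u ∧ x = v ∧ y then v ∧ (u ∧ x) = v ∧ v ∧ y = 0;
-- expanding this Plücker relation shows that u ∧ x is a multiple of u ∧ v, so dim (X_u ∩ X_v) = 1.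
-- The normalised vectors (leading nonzero coordinate 1) number 1 + q + ⋯ + q^(n-1) = (q^n - 1)/(q - 1).

open import Defs
open import Level using (Level; 0ℓ; _⊔_)
open import Algebra.Bundles using (CommutativeRing; RawRing)
open import Data.Nat as ℕ using (ℕ; zero; suc; _∸_; _^_; _≤_; s≤s)
import Data.Nat.Properties as ℕₚ
open import Data.Nat.Combinatorics using (_C_; nC1≡n; nCk+nC[k+1]≡[n+1]C[k+1])
open import Data.Fin as Fin using (Fin; zero; suc; punchIn; punchOut; splitAt; remQuot; _↑ˡ_; _↑ʳ_)
import Data.Fin.Properties as Finₚ
open import Data.Vec.Functional using (_∷_)
open import Data.Product as Product using (Σ; ∃; ∃₂; _×_; _,_; proj₁; proj₂)
import Data.Product.Properties as Productₚ
open import Data.Sum as Sum using (_⊎_; inj₁; inj₂)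
import Data.Maybe as Maybe
open import Data.Empty using (⊥-elim)
open import Function using (_∘_)
open import Relation.Nullary using (¬_; yes; no)
open import Relation.Binary.Definitions using (tri<; tri≈; tri>)
open import Relation.Binary.Consequences using (dec⇒weaklyDec)
open import Relation.Binary.PropositionalEquality as ≡ using (_≡_; _≢_)

geometricSum : ℕ → ℕ → ℕ
geometricSum q zero    = 0
geometricSum q (suc n) = q ^ n ℕ.+ geometricSum q n

geometricSum-*-pred+1 : ∀ r n → geometricSum (suc r) n ℕ.* r ℕ.+ 1 ≡ suc r ^ n
geometricSum-*-pred+1 r zero    = ≡.refl
geometricSum-*-pred+1 r (suc n) = begin
  (Q ℕ.+ S) ℕ.* r ℕ.+ 1         ≡⟨ ≡.cong (ℕ._+ 1) (ℕₚ.*-distribʳ-+ r Q S) ⟩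
  Q ℕ.* r ℕ.+ S ℕ.* r ℕ.+ 1     ≡⟨ ℕₚ.+-assoc (Q ℕ.* r) (S ℕ.* r) 1 ⟩
  Q ℕ.* r ℕ.+ (S ℕ.* r ℕ.+ 1)   ≡⟨ ≡.cong (Q ℕ.* r ℕ.+_) (geometricSum-*-pred+1 r n) ⟩
  Q ℕ.* r ℕ.+ Q                 ≡⟨ ℕₚ.+-comm (Q ℕ.* r) Q ⟩
  Q ℕ.+ Q ℕ.* r                 ≡⟨ ≡.cong (Q ℕ.+_) (ℕₚ.*-comm Q r) ⟩
  suc r ^ suc n                 ∎
  where
  open ≡.≡-Reasoning
  Q = suc r ^ n
  S = geometricSum (suc r) n

geometricSum-*-pred : ∀ {q} n → Fin q → geometricSum q n ℕ.* (q ∸ 1) ≡ q ^ n ∸ 1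
geometricSum-*-pred {suc r} n _ =
  ≡.trans (≡.sym (ℕₚ.m+n∸n≡m _ 1)) (≡.cong (_∸ 1) (geometricSum-*-pred+1 r n))

pairCount : ℕ → ℕ
pairCount zero    = 0
pairCount (suc n) = n ℕ.+ pairCount n

pairCount≡nC2 : ∀ n → pairCount n ≡ n C 2
pairCount≡nC2 zero    = ≡.refl
pairCount≡nC2 (suc n) =
  ≡.trans (≡.cong₂ ℕ._+_ (≡.sym (nC1≡n n)) (pairCount≡nC2 n)) (nCk+nC[k+1]≡[n+1]C[k+1] n 1)

pairAt : ∀ n → Fin (pairCount n) → Fin n × Fin n
pairAt (suc n) = Sum.[ (λ i → zero , suc i) , Product.map suc suc ∘ pairAt n ] ∘ splitAt n

pairAt-surjective : ∀ {n} {a b : Fin n} → a Fin.< b → ∃ λ k → pairAt n k ≡ (a , b)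
pairAt-surjective {suc n} {zero} {suc i} _ = i ↑ˡ pairCount n , pairAt-i
  where
  pairAt-i : pairAt (suc n) (i ↑ˡ pairCount n) ≡ (zero , suc i)
  pairAt-i rewrite Finₚ.splitAt-↑ˡ n i (pairCount n) = ≡.refl
pairAt-surjective {suc n} {suc a} {suc b} (s≤s a<b) with k , pairAt-k ← pairAt-surjective a<b =
  n ↑ʳ k , pairAt-k′
  where
  pairAt-k′ : pairAt (suc n) (n ↑ʳ k) ≡ (suc a , suc b)
  pairAt-k′ rewrite Finₚ.splitAt-↑ʳ n (pairCount n) k = ≡.cong (Product.map suc suc) pairAt-k

pair : ∀ {n} → Fin (n C 2) → Fin n × Fin n
pair {n} k = pairAt n (Fin.cast (≡.sym (pairCount≡nC2 n)) k)

pair-surjective : ∀ {n} {a b : Fin n} → a Fin.< b → ∃ λ k → pair k ≡ (a , b)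
pair-surjective {n} a<b with k , pairAt-k ← pairAt-surjective a<b =
  Fin.cast (pairCount≡nC2 n) k ,
  ≡.trans (≡.cong (pairAt n) (Finₚ.cast-involutive (≡.sym (pairCount≡nC2 n)) (pairCount≡nC2 n) k)) pairAt-k

splitAt-injective : ∀ m {n} {i j : Fin (m ℕ.+ n)} → splitAt m i ≡ splitAt m j → i ≡ j
splitAt-injective m {n} {i} {j} eq =
  ≡.trans (≡.sym (Finₚ.join-splitAt m n i)) (≡.trans (≡.cong (Fin.join m n) eq) (Finₚ.join-splitAt m n j))

remQuot-injective : ∀ {m} n {i j : Fin (m ℕ.* n)} → remQuot {m} n i ≡ remQuot n j → i ≡ j
remQuot-injective {m} n {i} {j} eq = ≡.trans (≡.sym (Finₚ.combine-remQuot {m} n i))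
  (≡.trans (≡.cong (Product.uncurry Fin.combine) eq) (Finₚ.combine-remQuot {m} n j))

module IntegerCoefficientSolver {c ℓ} (R : CommutativeRing c ℓ) where
  open CommutativeRing R
  open import Algebra.Properties.Semiring.Mult.TCOptimised semiring
    using (×-homo-+; ×1-homo-*) renaming (_×_ to _·_)
  open import Algebra.Properties.Ring ring using (x[y-z]≈xy-xz; [y-z]x≈yx-zx)
  open import Algebra.Properties.AbelianGroup +-abelianGroup using (⁻¹-∙-comm; ⁻¹-anti-homo‿-; ε⁻¹≈ε)
  open import Algebra.Properties.CommutativeSemigroup +-commutativeSemigroup using (interchange)
  open import Algebra.Solver.Ring.AlmostCommutativeRing
    using (fromCommutativeRing; _-Raw-AlmostCommutative⟶_)
  open import Relation.Binary.Reasoning.Setoid setoid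

  -- ℤ as pairs (a , b) standing for a - b; the operations keep one side zero,
  -- so that equal integers are equal pairs.
  private
    difference : ℕ → ℕ → ℕ × ℕ
    difference a b = a ∸ b , b ∸ a

    ℤ-rawRing : RawRing 0ℓ 0ℓ
    ℤ-rawRing = record
      { Carrier = ℕ × ℕ
      ; _≈_     = _≡_
      ; _+_     = λ { (a , b) (c , d) → difference (a ℕ.+ c) (b ℕ.+ d) }
      ; _*_     = λ { (a , b) (c , d) → difference (a ℕ.* c ℕ.+ b ℕ.* d) (a ℕ.* d ℕ.+ b ℕ.* c) }
      ; -_      = λ { (a , b) → b , a }
      ; 0#      = 0 , 0
      ; 1#      = 1 , 0
      }

    -- the case split makes ⟦ 0 , 0 ⟧ and ⟦ 1 , 0 ⟧ reduce to 0# and 1#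
    ⟦_⟧ : ℕ × ℕ → Carrier
    ⟦ a , zero  ⟧ = a · 1#
    ⟦ a , suc b ⟧ = a · 1# - suc b · 1#

    ⟦⟧-pair : ∀ a b → ⟦ a , b ⟧ ≈ a · 1# - b · 1#
    ⟦⟧-pair a zero    = sym (trans (+-congˡ ε⁻¹≈ε) (+-identityʳ _))
    ⟦⟧-pair a (suc b) = refl

    ⟦⟧-difference : ∀ a b → ⟦ difference a b ⟧ ≈ a · 1# - b · 1#
    ⟦⟧-difference zero    zero    = ⟦⟧-pair 0 0
    ⟦⟧-difference zero    (suc b) = ⟦⟧-pair 0 (suc b)
    ⟦⟧-difference (suc a) zero    = ⟦⟧-pair (suc a) 0
    ⟦⟧-difference (suc a) (suc b) = begin
      ⟦ difference a b ⟧         ≈⟨ ⟦⟧-difference a b ⟩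
      A - B                      ≈⟨ sym (+-identityˡ _) ⟩
      0# + (A - B)               ≈⟨ +-congʳ (sym (-‿inverseʳ 1#)) ⟩
      (1# - 1#) + (A - B)        ≈⟨ interchange 1# (- 1#) A (- B) ⟩
      (1# + A) + (- 1# + - B)    ≈⟨ +-congˡ (⁻¹-∙-comm 1# B) ⟩
      (1# + A) - (1# + B)        ≈⟨ sym (+-cong (×-homo-+ 1# 1 a) (-‿cong (×-homo-+ 1# 1 b))) ⟩
      suc a · 1# - suc b · 1#    ∎
      where A = a · 1#; B = b · 1#

    +-homo : ∀ a b c d → ⟦ difference (a ℕ.+ c) (b ℕ.+ d) ⟧ ≈ ⟦ a , b ⟧ + ⟦ c , d ⟧
    +-homo a b c d = begin
      ⟦ difference (a ℕ.+ c) (b ℕ.+ d) ⟧  ≈⟨ ⟦⟧-difference (a ℕ.+ c) (b ℕ.+ d) ⟩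
      (a ℕ.+ c) · 1# - (b ℕ.+ d) · 1#     ≈⟨ +-cong (×-homo-+ 1# a c) (-‿cong (×-homo-+ 1# b d)) ⟩
      (A + C′) - (B + D)                  ≈⟨ +-congˡ (sym (⁻¹-∙-comm B D)) ⟩
      (A + C′) + (- B + - D)              ≈⟨ interchange A C′ (- B) (- D) ⟩
      (A - B) + (C′ - D)                  ≈⟨ sym (+-cong (⟦⟧-pair a b) (⟦⟧-pair c d)) ⟩
      ⟦ a , b ⟧ + ⟦ c , d ⟧               ∎
      where A = a · 1#; B = b · 1#; C′ = c · 1#; D = d · 1#

    *-homo : ∀ a b c d →
             ⟦ difference (a ℕ.* c ℕ.+ b ℕ.* d) (a ℕ.* d ℕ.+ b ℕ.* c) ⟧ ≈ ⟦ a , b ⟧ * ⟦ c , d ⟧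
    *-homo a b c d = begin
      ⟦ difference (a ℕ.* c ℕ.+ b ℕ.* d) (a ℕ.* d ℕ.+ b ℕ.* c) ⟧
        ≈⟨ ⟦⟧-difference (a ℕ.* c ℕ.+ b ℕ.* d) (a ℕ.* d ℕ.+ b ℕ.* c) ⟩
      (a ℕ.* c ℕ.+ b ℕ.* d) · 1# - (a ℕ.* d ℕ.+ b ℕ.* c) · 1#
        ≈⟨ +-cong (homo₂ a c b d) (-‿cong (homo₂ a d b c)) ⟩
      (A * C′ + B * D) - (A * D + B * C′)
        ≈⟨ +-congˡ (sym (⁻¹-∙-comm (A * D) (B * C′))) ⟩
      (A * C′ + B * D) + (- (A * D) + - (B * C′))
        ≈⟨ interchange (A * C′) (B * D) (- (A * D)) (- (B * C′)) ⟩
      (A * C′ - A * D) + (B * D - B * C′)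
        ≈⟨ +-congˡ (sym (⁻¹-anti-homo‿- (B * C′) (B * D))) ⟩
      (A * C′ - A * D) - (B * C′ - B * D)
        ≈⟨ +-cong (sym (x[y-z]≈xy-xz A C′ D)) (-‿cong (sym (x[y-z]≈xy-xz B C′ D))) ⟩
      A * (C′ - D) - B * (C′ - D)
        ≈⟨ sym ([y-z]x≈yx-zx (C′ - D) A B) ⟩
      (A - B) * (C′ - D)
        ≈⟨ sym (*-cong (⟦⟧-pair a b) (⟦⟧-pair c d)) ⟩
      ⟦ a , b ⟧ * ⟦ c , d ⟧ ∎
      where
      A = a · 1#; B = b · 1#; C′ = c · 1#; D = d · 1#
      homo₂ : ∀ k l m n → (k ℕ.* l ℕ.+ m ℕ.* n) · 1# ≈ k · 1# * l · 1# + m · 1# * n · 1#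
      homo₂ k l m n = trans (×-homo-+ 1# (k ℕ.* l) (m ℕ.* n)) (+-cong (×1-homo-* k l) (×1-homo-* m n))

    homomorphism : ℤ-rawRing -Raw-AlmostCommutative⟶ fromCommutativeRing R
    homomorphism = record
      { ⟦_⟧    = ⟦_⟧
      ; +-homo = λ { (a , b) (c , d) → +-homo a b c d }
      ; *-homo = λ { (a , b) (c , d) → *-homo a b c d }
      ; -‿homo = λ { (a , b) → trans (⟦⟧-pair b a)
                                      (trans (sym (⁻¹-anti-homo‿- _ _)) (-‿cong (sym (⟦⟧-pair a b)))) }
      ; 0-homo = refl
      ; 1-homo = refl
      }

    ⟦⟧-≟ : ∀ x y → Maybe.Maybe (⟦ x ⟧ ≈ ⟦ y ⟧)
    ⟦⟧-≟ x y = Maybe.map (λ { ≡.refl → refl }) (dec⇒weaklyDec (Productₚ.≡-dec ℕₚ._≟_ ℕₚ._≟_) x y)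

  open import Algebra.Solver.Ring ℤ-rawRing (fromCommutativeRing R) homomorphism ⟦⟧-≟
    public using (solve; _:+_; _:*_; _:-_; :-_; _:=_; con)

module _ {c ℓ : Level} {q : ℕ} (F : FiniteField c ℓ q) where
  open FiniteField F hiding (zero)
  open IsField isField
  open LinAlg F
  open IntegerCoefficientSolver cring using (solve; _:+_; _:*_; _:-_; :-_; _:=_; con)
  open import Algebra.Properties.AbelianGroup +-abelianGroup using (ε⁻¹≈ε; x∙y⁻¹≈ε⇒x≈y)
  open import Relation.Binary.Reasoning.Setoid setoid

  1≉0 : ¬ 1# ≈ 0#
  1≉0 = 0≉1 ∘ sym

  divide : ∀ {d e z s} → d * e ≈ 1# → d * z ≈ s → z ≈ e * s
  divide {d} {e} {z} {s} de≈1 dz≈s = begin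
    z             ≈⟨ sym (*-identityˡ z) ⟩
    1# * z        ≈⟨ *-congʳ (sym de≈1) ⟩
    (d * e) * z   ≈⟨ solve 3 (λ d e z → (d :* e) :* z := e :* (d :* z)) refl d e z ⟩
    e * (d * z)   ≈⟨ *-congˡ dz≈s ⟩
    e * s         ∎

  Σᶠ-cong : ∀ k {f g : Fin k → Carrier} → (∀ j → f j ≈ g j) → Σᶠ k f ≈ Σᶠ k g
  Σᶠ-cong zero    f≈g = refl
  Σᶠ-cong (suc k) f≈g = +-cong (f≈g zero) (Σᶠ-cong k (f≈g ∘ suc))

  Σᶠ-zero : ∀ k {f : Fin k → Carrier} → (∀ j → f j ≈ 0#) → Σᶠ k f ≈ 0#
  Σᶠ-zero zero    f≈0 = refl
  Σᶠ-zero (suc k) f≈0 = trans (+-cong (f≈0 zero) (Σᶠ-zero k (f≈0 ∘ suc))) (+-identityʳ 0#)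

  Σᶠ-single : ∀ k (f : Fin k → Carrier) j → (∀ i → i ≢ j → f i ≈ 0#) → Σᶠ k f ≈ f j
  Σᶠ-single (suc k) f zero    f≈0 =
    trans (+-congˡ (Σᶠ-zero k (λ i → f≈0 (suc i) λ ()))) (+-identityʳ _)
  Σᶠ-single (suc k) f (suc j) f≈0 =
    trans (+-cong (f≈0 zero λ ()) (Σᶠ-single k (f ∘ suc) j (λ i i≢j → f≈0 (suc i) (i≢j ∘ Finₚ.suc-injective))))
          (+-identityˡ _)

  Σᶠ-*ˡ : ∀ k a (f : Fin k → Carrier) → Σᶠ k (λ j → a * f j) ≈ a * Σᶠ k f
  Σᶠ-*ˡ zero    a f = sym (zeroʳ a)
  Σᶠ-*ˡ (suc k) a f = trans (+-congˡ (Σᶠ-*ˡ k a (f ∘ suc))) (sym (distribˡ a (f zero) _))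

  Σᶠ-sub : ∀ k (f g : Fin k → Carrier) → Σᶠ k (λ j → f j - g j) ≈ Σᶠ k f - Σᶠ k g
  Σᶠ-sub zero    f g = sym (-‿inverseʳ 0#)
  Σᶠ-sub (suc k) f g = trans (+-congˡ (Σᶠ-sub k (f ∘ suc) (g ∘ suc)))
    (solve 4 (λ a b A B → (a :- b) :+ (A :- B) := (a :+ A) :- (b :+ B)) refl
      (f zero) (g zero) (Σᶠ k (f ∘ suc)) (Σᶠ k (g ∘ suc)))

  δ : ∀ {n} → Fin n → Vector n
  δ a b with a Fin.≟ b
  ... | yes _ = 1#
  ... | no  _ = 0#

  δ-diag : ∀ {n} (a : Fin n) → δ a a ≈ 1#
  δ-diag a with a Fin.≟ a
  ... | yes _   = refl
  ... | no  a≢a = ⊥-elim (a≢a ≡.refl)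

  δ-off : ∀ {n} {a b : Fin n} → a ≢ b → δ a b ≈ 0#
  δ-off {a = a} {b} a≢b with a Fin.≟ b
  ... | yes a≡b = ⊥-elim (a≢b a≡b)
  ... | no  _   = refl

  lincomb-δ : ∀ {N k} (b : Fin k → Vector N) j i → lincomb (λ t → δ t j) b i ≈ b j i
  lincomb-δ {k = k} b j i =
    trans (Σᶠ-single k _ j (λ t t≢j → trans (*-congʳ (δ-off t≢j)) (zeroˡ _)))
          (trans (*-congʳ (δ-diag j)) (*-identityˡ _))

  ∈ₛ-resp-≈ : ∀ {N k} (X : Subspace N k) {v w : Vector N} → (∀ i → v i ≈ w i) → v ∈ₛ X → w ∈ₛ X
  ∈ₛ-resp-≈ X v≈w (coef , v≈comb) = coef , λ i → trans (sym (v≈w i)) (v≈comb i)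

  basis-∈ₛ : ∀ {N k} (X : Subspace N k) j → basis X j ∈ₛ X
  basis-∈ₛ X j = (λ t → δ t j) , λ i → sym (lincomb-δ (basis X) j i)

  basis-nonzero : ∀ {N k} (X : Subspace N k) j → ¬ IsZero (basis X j)
  basis-nonzero X j bⱼ≈0 =
    1≉0 (trans (sym (δ-diag j)) (indep X (λ t → δ t j) (λ i → trans (lincomb-δ (basis X) j i) (bⱼ≈0 i)) j))

  basis-not-collinear : ∀ {N m} (X : Subspace N (suc (suc m))) (w : Vector N) →
                        ¬ (∀ j → ∃ λ α → ∀ i → basis X j i ≈ α * w i)
  basis-not-collinear {m = m} X w collinear =
    basis-nonzero X (suc zero) (λ i → trans (b₁≈α₁w i) (trans (*-congʳ α₁≈0) (zeroˡ (w i))))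
    where
    α₀ α₁ : Carrier
    α₀ = proj₁ (collinear zero)
    α₁ = proj₁ (collinear (suc zero))
    b₀≈α₀w : ∀ i → basis X zero i ≈ α₀ * w i
    b₀≈α₀w = proj₂ (collinear zero)
    b₁≈α₁w : ∀ i → basis X (suc zero) i ≈ α₁ * w i
    b₁≈α₁w = proj₂ (collinear (suc zero))
    -- α₁ b₀ - α₀ b₁ = 0 is a dependence relation unless α₁ = 0
    coef : Fin (suc (suc m)) → Carrier
    coef zero             = α₁
    coef (suc zero)       = - α₀
    coef (suc (suc _))    = 0#
    relation : IsZero (lincomb coef (basis X))
    relation i = trans
      (+-cong (*-congˡ (b₀≈α₀w i)) (+-cong (*-congˡ (b₁≈α₁w i)) (Σᶠ-zero m (λ _ → zeroˡ _))))
      (solve 3 (λ a₀ a₁ wᵢ → a₁ :* (a₀ :* wᵢ) :+ ((:- a₀) :* (a₁ :* wᵢ) :+ con (0 , 0)) := con (0 , 0))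
             refl α₀ α₁ (w i))
    α₁≈0 : α₁ ≈ 0#
    α₁≈0 = indep X coef relation zero

  intersectionDim1⇒¬same : ∀ {N m} (X Y : Subspace N (suc (suc m))) →
                           IntersectionDim1 X Y → ¬ SameSubspace X Y
  intersectionDim1⇒¬same X Y (v , _ , _ , _ , on-line) (X⊆Y , _) =
    basis-not-collinear X v (λ j → on-line (basis X j) (basis-∈ₛ X j) (X⊆Y _ (basis-∈ₛ X j)))

  wedge : ∀ {n} → Vector n → Vector n → Fin n → Fin n → Carrier
  wedge u x a b = u a * x b - u b * x a

  _⋀_ : ∀ {n} → Vector n → Vector n → Vector (n C 2)
  (u ⋀ x) k = wedge u x (proj₁ (pair k)) (proj₂ (pair k))

  wedge-cong : ∀ {n} (u : Vector n) {x y : Vector n} → (∀ t → x t ≈ y t) →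
               ∀ a b → wedge u x a b ≈ wedge u y a b
  wedge-cong u x≈y a b = +-cong (*-congˡ (x≈y b)) (-‿cong (*-congˡ (x≈y a)))

  Alternating : ∀ {n} → (Fin n → Fin n → Carrier) → Set ℓ
  Alternating f = (∀ a → f a a ≈ 0#) × (∀ a b → f a b ≈ - f b a)

  wedge-alternating : ∀ {n} (u x : Vector n) → Alternating (wedge u x)
  wedge-alternating u x =
    (λ a → solve 2 (λ ua xa → ua :* xa :- ua :* xa := con (0 , 0)) refl (u a) (x a)) ,
    (λ a b → solve 4 (λ ua ub xa xb → ua :* xb :- ub :* xa := :- (ub :* xa :- ua :* xb))
                     refl (u a) (u b) (x a) (x b))

  zero-alternating : ∀ {n} → Alternating {n} (λ _ _ → 0#)
  zero-alternating = (λ _ → refl) , (λ _ _ → sym ε⁻¹≈ε)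

  alternating-ext : ∀ {n} {f g : Fin n → Fin n → Carrier} → Alternating f → Alternating g →
                    (∀ k → f (proj₁ (pair k)) (proj₂ (pair k)) ≈ g (proj₁ (pair k)) (proj₂ (pair k))) →
                    ∀ a b → f a b ≈ g a b
  alternating-ext {f = f} {g} (f-diag , f-anti) (g-diag , g-anti) f≈g = ext
    where
    ext-< : ∀ {a b} → a Fin.< b → f a b ≈ g a b
    ext-< a<b with k , pair-k ← pair-surjective a<b =
      ≡.subst (λ (a , b) → f a b ≈ g a b) pair-k (f≈g k)
    ext : ∀ a b → f a b ≈ g a b
    ext a b with Finₚ.<-cmp a b
    ... | tri< a<b _ _      = ext-< a<b
    ... | tri≈ _ ≡.refl _   = trans (f-diag a) (sym (g-diag a))
    ... | tri> _ _ b<a      = trans (f-anti a b) (trans (-‿cong (ext-< b<a)) (sym (g-anti a b)))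

  ⋀-ext : ∀ {n} (u x v y : Vector n) → (∀ k → (u ⋀ x) k ≈ (v ⋀ y) k) → ∀ a b → wedge u x a b ≈ wedge v y a b
  ⋀-ext u x v y = alternating-ext (wedge-alternating u x) (wedge-alternating v y)

  ⋀-zero : ∀ {n} (u x : Vector n) → IsZero (u ⋀ x) → ∀ a b → wedge u x a b ≈ 0#
  ⋀-zero u x = alternating-ext (wedge-alternating u x) zero-alternating

  ⋀-lincomb : ∀ {n k} (u : Vector n) (c : Fin k → Carrier) (b : Fin k → Vector n) →
              ∀ i → lincomb c (λ j → u ⋀ b j) i ≈ (u ⋀ lincomb c b) i
  ⋀-lincomb {k = k} u c b i = begin
    Σᶠ k (λ j → c j * (u s * b j t - u t * b j s))
      ≈⟨ Σᶠ-cong k (λ j → solve 5 (λ cⱼ us ut x y → cⱼ :* (us :* x :- ut :* y)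
                                                    := us :* (cⱼ :* x) :- ut :* (cⱼ :* y))
                                  refl (c j) (u s) (u t) (b j t) (b j s)) ⟩
    Σᶠ k (λ j → u s * (c j * b j t) - u t * (c j * b j s))
      ≈⟨ Σᶠ-sub k _ _ ⟩
    Σᶠ k (λ j → u s * (c j * b j t)) - Σᶠ k (λ j → u t * (c j * b j s))
      ≈⟨ +-cong (Σᶠ-*ˡ k (u s) _) (-‿cong (Σᶠ-*ˡ k (u t) _)) ⟩
    (u ⋀ lincomb c b) i ∎
    where
    s = proj₁ (pair i)
    t = proj₂ (pair i)

  wedge-swap : ∀ {n} (u v : Vector n) a b → wedge u v a b ≈ wedge v (λ t → - u t) a b
  wedge-swap u v a b =
    solve 4 (λ ua ub va vb → ua :* vb :- ub :* va := va :* (:- ub) :- vb :* (:- ua))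
          refl (u a) (u b) (v a) (v b)

  wedge-shift : ∀ {n} (u x : Vector n) s a b → wedge u x a b ≈ wedge u (λ t → x t - s * u t) a b
  wedge-shift u x s a b =
    solve 5 (λ ua ub xa xb s → ua :* xb :- ub :* xa := ua :* (xb :- s :* ub) :- ub :* (xa :- s :* ua))
          refl (u a) (u b) (x a) (x b) s

  -- the coordinate (a, b, t) of v ∧ w for a 2-form w
  wedge₃ : ∀ {n} → Vector n → (Fin n → Fin n → Carrier) → Fin n → Fin n → Fin n → Carrier
  wedge₃ v w a b t = w a b * v t - w a t * v b + w b t * v a

  wedge₃-cong : ∀ {n} (v : Vector n) {w w′ : Fin n → Fin n → Carrier} → (∀ a b → w a b ≈ w′ a b) →
                ∀ a b t → wedge₃ v w a b t ≈ wedge₃ v w′ a b t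
  wedge₃-cong v w≈w′ a b t =
    +-cong (+-cong (*-congʳ (w≈w′ a b)) (-‿cong (*-congʳ (w≈w′ a t)))) (*-congʳ (w≈w′ b t))

  wedge₃-self : ∀ {n} (v y : Vector n) a b t → wedge₃ v (wedge v y) a b t ≈ 0#
  wedge₃-self v y a b t =
    solve 6 (λ va vb vt ya yb yt →
               (va :* yb :- vb :* ya) :* vt :- (va :* yt :- vt :* ya) :* vb :+ (vb :* yt :- vt :* yb) :* va
               := con (0 , 0))
          refl (v a) (v b) (v t) (y a) (y b) (y t)

  plücker : ∀ {n} (u v x : Vector n) a b i j →
            wedge u v a b * wedge u x i j ≈
            wedge u x a b * wedge u v i j
              - (u i * wedge₃ v (wedge u x) a b j - u j * wedge₃ v (wedge u x) a b i)
  plücker u v x a b i j =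
    solve 12 (λ ua ub ui uj xa xb xi xj va vb vi vj →
                (ua :* vb :- ub :* va) :* (ui :* xj :- uj :* xi) :=
                (ua :* xb :- ub :* xa) :* (ui :* vj :- uj :* vi)
                :- (ui :* ((ua :* xb :- ub :* xa) :* vj :- (ua :* xj :- uj :* xa) :* vb
                           :+ (ub :* xj :- uj :* xb) :* va)
                    :- uj :* ((ua :* xb :- ub :* xa) :* vi :- (ua :* xi :- ui :* xa) :* vb
                              :+ (ub :* xi :- ui :* xb) :* va)))
          refl (u a) (u b) (u i) (u j) (x a) (x b) (x i) (x j) (v a) (v b) (v i) (v j)

  wedge-proportional : ∀ {n} (u v x y : Vector n) → (∀ a b → wedge u x a b ≈ wedge v y a b) →
                       ∀ a b i j → wedge u v a b * wedge u x i j ≈ wedge u x a b * wedge u v i j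
  wedge-proportional {n} u v x y ux≈vy a b i j = begin
    wedge u v a b * wedge u x i j
      ≈⟨ plücker u v x a b i j ⟩
    wedge u x a b * wedge u v i j - (u i * R j - u j * R i)
      ≈⟨ +-congˡ (-‿cong (+-cong (*-congˡ (R≈0 j)) (-‿cong (*-congˡ (R≈0 i))))) ⟩
    wedge u x a b * wedge u v i j - (u i * 0# - u j * 0#)
      ≈⟨ solve 3 (λ z s t → z :- (s :* con (0 , 0) :- t :* con (0 , 0)) := z)
               refl (wedge u x a b * wedge u v i j) (u i) (u j) ⟩
    wedge u x a b * wedge u v i j ∎
    where
    R : Fin n → Carrier
    R = wedge₃ v (wedge u x) a b
    R≈0 : ∀ t → R t ≈ 0#
    R≈0 t = trans (wedge₃-cong v ux≈vy a b t) (wedge₃-self v y a b t)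

  record Normalised (n : ℕ) : Set (c ⊔ ℓ) where
    field
      vector         : Vector n
      pivot          : Fin n
      vector-pivot≈1 : vector pivot ≈ 1#
  open Normalised

  module _ {m} (P : Normalised (suc m)) where
    private
      u : Vector (suc m)
      u = vector P
      p : Fin (suc m)
      p = pivot P
      σ : Fin m → Fin (suc m)
      σ = punchIn p

    spread : (Fin m → Carrier) → Vector (suc m)
    spread c = lincomb c (δ ∘ σ)

    spread-pivot : ∀ c → spread c p ≈ 0#
    spread-pivot c = Σᶠ-zero m (λ j → trans (*-congˡ (δ-off (Finₚ.punchInᵢ≢i p j))) (zeroʳ _))

    spread-punchIn : ∀ c j → spread c (σ j) ≈ c j
    spread-punchIn c j =
      trans (Σᶠ-single m _ j λ i i≢j → trans (*-congˡ (δ-off (i≢j ∘ Finₚ.punchIn-injective p i j))) (zeroʳ _))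
            (trans (*-congˡ (δ-diag (σ j))) (*-identityʳ _))

    spread-restrict : ∀ x → x p ≈ 0# → ∀ t → spread (x ∘ σ) t ≈ x t
    spread-restrict x xₚ≈0 t with p Fin.≟ t
    ... | yes ≡.refl = trans (spread-pivot _) (sym xₚ≈0)
    ... | no  p≢t    = ≡.subst (λ s → spread (x ∘ σ) s ≈ x s) (Finₚ.punchIn-punchOut p≢t)
                               (spread-punchIn _ (punchOut p≢t))

    wedgeBasis : Fin m → Vector (suc m C 2)
    wedgeBasis j = u ⋀ δ (σ j)

    wedgeBasis-independent : LinIndep wedgeBasis
    wedgeBasis-independent c comb≈0 j = begin
      c j
        ≈⟨ solve 2 (λ cⱼ s → cⱼ := con (1 , 0) :* cⱼ :- s :* con (0 , 0)) refl (c j) (u (σ j)) ⟩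
      1# * c j - u (σ j) * 0#
        ≈⟨ sym (+-cong (*-cong (vector-pivot≈1 P) (spread-punchIn c j)) (-‿cong (*-congˡ (spread-pivot c)))) ⟩
      wedge u (spread c) p (σ j)
        ≈⟨ ⋀-zero u (spread c) (λ i → trans (sym (⋀-lincomb u c (δ ∘ σ) i)) (comb≈0 i)) p (σ j) ⟩
      0# ∎

    wedgeSpace : Subspace (suc m C 2) m
    wedgeSpace = record { basis = wedgeBasis ; indep = wedgeBasis-independent }

    ⋀-∈-wedgeSpace : ∀ x → (u ⋀ x) ∈ₛ wedgeSpace
    ⋀-∈-wedgeSpace x = x′ ∘ σ , λ k → begin
      (u ⋀ x) k                       ≈⟨ wedge-shift u x (x p) _ _ ⟩
      (u ⋀ x′) k                      ≈⟨ wedge-cong u (λ t → sym (spread-restrict x′ x′ₚ≈0 t)) _ _ ⟩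
      (u ⋀ spread (x′ ∘ σ)) k         ≈⟨ sym (⋀-lincomb u (x′ ∘ σ) (δ ∘ σ) k) ⟩
      lincomb (x′ ∘ σ) wedgeBasis k   ∎
      where
      x′ : Vector (suc m)
      x′ t = x t - x p * u t
      x′ₚ≈0 : x′ p ≈ 0#
      x′ₚ≈0 = trans (+-congˡ (-‿cong (*-congˡ (vector-pivot≈1 P))))
                    (solve 1 (λ s → s :- s :* con (1 , 0) := con (0 , 0)) refl (x p))

    ∈-wedgeSpace⇒⋀ : ∀ w → w ∈ₛ wedgeSpace → ∃ λ x → ∀ k → w k ≈ (u ⋀ x) k
    ∈-wedgeSpace⇒⋀ w (c , w≈comb) = spread c , λ k → trans (w≈comb k) (⋀-lincomb u c (δ ∘ σ) k)

  Independent : ∀ {n} → Vector n → Vector n → Set ℓ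
  Independent u v = ∃₂ λ a b → ¬ wedge u v a b ≈ 0#

  wedge-flip : ∀ {n} (u v : Vector n) a b → wedge u v a b ≈ wedge v u b a
  wedge-flip u v a b =
    solve 4 (λ ua ub va vb → ua :* vb :- ub :* va := vb :* ua :- va :* ub) refl (u a) (u b) (v a) (v b)

  independent-sym : ∀ {n} {u v : Vector n} → Independent u v → Independent v u
  independent-sym {u = u} {v} (a , b , uv≉0) = b , a , uv≉0 ∘ trans (wedge-flip u v a b)

  ⋀-proportional : ∀ {n} (u v x y : Vector n) {a b} → ¬ wedge u v a b ≈ 0# →
                   (∀ k → (u ⋀ x) k ≈ (v ⋀ y) k) → ∃ λ α → ∀ k → (u ⋀ x) k ≈ α * (u ⋀ v) k
  ⋀-proportional u v x y {a} {b} uv≉0 ux≈vy with e , de≈1 ← inverse (wedge u v a b) uv≉0 =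
    e * wedge u x a b , λ k → begin
      (u ⋀ x) k
        ≈⟨ divide de≈1 (wedge-proportional u v x y (⋀-ext u x v y ux≈vy) a b (proj₁ (pair k)) (proj₂ (pair k))) ⟩
      e * (wedge u x a b * (u ⋀ v) k)
        ≈⟨ sym (*-assoc e (wedge u x a b) ((u ⋀ v) k)) ⟩
      e * wedge u x a b * (u ⋀ v) k ∎

  wedgeSpace-∩ : ∀ {m} (P Q : Normalised (suc m)) → Independent (vector P) (vector Q) →
                 IntersectionDim1 (wedgeSpace P) (wedgeSpace Q)
  wedgeSpace-∩ {m} P Q (a , b , uv≉0) =
    u ⋀ v , (λ uv≈0 → uv≉0 (⋀-zero u v uv≈0 a b)) , ⋀-∈-wedgeSpace P v ,
    ∈ₛ-resp-≈ (wedgeSpace Q) (λ k → sym (wedge-swap u v (proj₁ (pair k)) (proj₂ (pair k))))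
              (⋀-∈-wedgeSpace Q (λ t → - u t)) ,
    on-line
    where
    u v : Vector (suc m)
    u = vector P
    v = vector Q
    on-line : ∀ w → w ∈ₛ wedgeSpace P → w ∈ₛ wedgeSpace Q → ∃ λ α → ∀ k → w k ≈ α * (u ⋀ v) k
    on-line w w∈P w∈Q =
      let x , w≈ux = ∈-wedgeSpace⇒⋀ P w w∈P
          y , w≈vy = ∈-wedgeSpace⇒⋀ Q w w∈Q
          α , ux≈αuv = ⋀-proportional u v x y uv≉0 (λ k → trans (sym (w≈ux k)) (w≈vy k))
      in α , λ k → trans (w≈ux k) (ux≈αuv k)

  vectors : ∀ n → Fin (q ^ n) → Vector n
  vectors zero    _ ()
  vectors (suc n) = Product.uncurry (λ x i → enum x ∷ vectors n i) ∘ remQuot {q} (q ^ n)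

  vectors-distinct : ∀ n {i j} → i ≢ j → ∃ λ t → ¬ vectors n i t ≈ vectors n j t
  vectors-distinct zero    {zero} {zero} i≢i = ⊥-elim (i≢i ≡.refl)
  vectors-distinct (suc n) {i} {j} i≢j
    with proj₁ (remQuot {q} (q ^ n) i) Fin.≟ proj₁ (remQuot {q} (q ^ n) j)
  ... | no  x≢y = zero , x≢y ∘ enum-inj _ _
  ... | yes x≡y =
    let t , differ = vectors-distinct n λ i′≡j′ →
                       i≢j (remQuot-injective {q} (q ^ n) (Productₚ.×-≡,≡→≡ (x≡y , i′≡j′)))
    in suc t , differ

  leadingOne : ∀ {n} → Vector n → Normalised (suc n)
  leadingOne x = record { vector = 1# ∷ x ; pivot = zero ; vector-pivot≈1 = refl }

  leadingZero : ∀ {n} → Normalised n → Normalised (suc n)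
  leadingZero P = record
    { vector = 0# ∷ vector P ; pivot = suc (pivot P) ; vector-pivot≈1 = vector-pivot≈1 P }

  leadingOne-independent : ∀ {n} {x y : Vector n} t → ¬ x t ≈ y t →
                           Independent (vector (leadingOne x)) (vector (leadingOne y))
  leadingOne-independent {x = x} {y} t xₜ≉yₜ = zero , suc t , λ w≈0 →
    xₜ≉yₜ (sym (x∙y⁻¹≈ε⇒x≈y (y t) (x t) (trans
      (solve 2 (λ xₜ yₜ → yₜ :- xₜ := con (1 , 0) :* yₜ :- xₜ :* con (1 , 0)) refl (x t) (y t))
      w≈0)))

  leadingOne-leadingZero-independent : ∀ {n} x (P : Normalised n) →
                                       Independent (vector (leadingOne x)) (vector (leadingZero P))
  leadingOne-leadingZero-independent x P = zero , suc (pivot P) , λ w≈0 →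
    1≉0 (trans (sym (vector-pivot≈1 P)) (trans
      (solve 2 (λ xₚ vₚ → vₚ := con (1 , 0) :* vₚ :- xₚ :* con (0 , 0)) refl (x (pivot P)) (vector P (pivot P)))
      w≈0))

  leadingZero-independent : ∀ {n} {P Q : Normalised n} → Independent (vector P) (vector Q) →
                            Independent (vector (leadingZero P)) (vector (leadingZero Q))
  leadingZero-independent (a , b , uv≉0) = suc a , suc b , uv≉0

  points : ∀ n → Fin (geometricSum q n) → Normalised n
  points-independent : ∀ n {i j} → i ≢ j → Independent (vector (points n i)) (vector (points n j))

  extend : ∀ n → Fin (q ^ n) ⊎ Fin (geometricSum q n) → Normalised (suc n)
  extend n = Sum.[ leadingOne ∘ vectors n , leadingZero ∘ points n ]

  extend-independent : ∀ n {s s′} → s ≢ s′ → Independent (vector (extend n s)) (vector (extend n s′))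
  extend-independent n {inj₁ i} {inj₁ j} s≢s′ =
    Product.uncurry leadingOne-independent (vectors-distinct n (s≢s′ ∘ ≡.cong inj₁))
  extend-independent n {inj₁ i} {inj₂ j} _ = leadingOne-leadingZero-independent (vectors n i) (points n j)
  extend-independent n {inj₂ i} {inj₁ j} _ =
    independent-sym (leadingOne-leadingZero-independent (vectors n j) (points n i))
  extend-independent n {inj₂ i} {inj₂ j} s≢s′ =
    leadingZero-independent {P = points n i} {points n j} (points-independent n (s≢s′ ∘ ≡.cong inj₂))

  points (suc n) = extend n ∘ splitAt (q ^ n)

  points-independent (suc n) i≢j = extend-independent n (i≢j ∘ splitAt-injective (q ^ n))

theorem15 : ∀ (n q : ℕ) → 3 ≤ n → IsPrimePower q →
  ∀ {c ℓ : Level} (F : FiniteField c ℓ q) →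
  let open LinAlg F in
  Σ ℕ λ M → (M ℕ.* (q ∸ 1) ≡ q ^ n ∸ 1) ×
    Σ (Fin M → Subspace (n C 2) (n ∸ 1)) λ code →
      ∀ (i j : Fin M) → i ≢ j →
        ¬ SameSubspace (code i) (code j) × IntersectionDim1 (code i) (code j)
theorem15 .(suc (suc (suc m))) q (s≤s (s≤s (s≤s {n = m} _))) _ F =
  geometricSum q n , geometricSum-*-pred n (proj₁ (enum-surj 0#)) ,
  code , λ i j i≢j →
    let ∩-dim1 = wedgeSpace-∩ F (points F n i) (points F n j) (points-independent F n i≢j)
    in intersectionDim1⇒¬same F (code i) (code j) ∩-dim1 , ∩-dim1
  where
  open FiniteField F using (enum-surj; 0#)
  n : ℕ
  n = suc (suc (suc m))
  code : Fin (geometricSum q n) → LinAlg.Subspace F (n C 2) (n ∸ 1)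
  code = wedgeSpace F ∘ points F n
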